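{- Let $\Gamma$ be a finite simple connected graph with at least two vertices such that $\Gamma_2\cong\Gamma$, $\Gamma$ contains no subgraph isomorphic to $C_4$, and $\Gamma$ is not a cycle of odd length. If $\Gamma$ has a subgraph isomorphic to $C_5|C_3$, then $\Gamma\cong C_5|C_3$.
   Context: For a finite simple graph $\Gamma$ with path-distance $d$, $\Gamma_2$ is the graph on $V(\Gamma)$ with $u,v$ adjacent iff $d(u,v)=2$. $C_5|C_3$ denotes the graph on six vertices $a,b,c,d,e,f$ with edges $ab,bc,cd,de,ef,fa,bf$ (a $6$-cycle with one chord joining two vertices at distance two on the cycle; equivalently a pentagon and a triangle sharing an edge). "Subgraph" means a not necessarily induced subgraph. -}

module Defs where

open import Data.Nat using (ℕ; zero; suc; _+_; _*_; _≤_; _%_; z≤n; s≤s)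
open import Data.Nat.Properties using (+-suc)
open import Data.Fin using (Fin; toℕ; fromℕ<)
open import Data.Fin.Patterns using (0F; 1F; 2F; 3F; 4F; 5F)
open import Data.Product using (Σ; ∃; ∃-syntax; _×_; _,_; proj₁; proj₂)
open import Data.Sum using (_⊎_; inj₁; inj₂)
import Data.Sum
open import Data.Empty using (⊥)
open import Data.Unit using (⊤)
open import Relation.Nullary using (¬_)
open import Relation.Binary.PropositionalEquality using (_≡_)
import Relation.Binary.PropositionalEquality as Eq
open import Function.Bundles using (_↔_; Inverse)
open import Function.Definitions using (Injective)

record Graph : Set₁ where
  field
    n      : ℕ
    Adj    : Fin n → Fin n → Set
    sym    : ∀ {u v} → Adj u v → Adj v u
    irrefl : ∀ {u} → ¬ Adj u u

open Graph public

data Walk (Γ : Graph) : Fin (n Γ) → Fin (n Γ) → ℕ → Set where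
  []  : ∀ {u} → Walk Γ u u zero
  _∷_ : ∀ {u w v k} → Adj Γ u w → Walk Γ w v k → Walk Γ u v (suc k)

snoc : ∀ {Γ u w v k} → Walk Γ u w k → Adj Γ w v → Walk Γ u v (suc k)
snoc [] e = e ∷ []
snoc (e ∷ p) f = e ∷ snoc p f

reverse : ∀ {Γ u v k} → Walk Γ u v k → Walk Γ v u k
reverse [] = []
reverse {Γ} (e ∷ p) = snoc (reverse p) (sym Γ e)

Dist : (Γ : Graph) → Fin (n Γ) → Fin (n Γ) → ℕ → Set
Dist Γ u v k = Walk Γ u v k × (∀ j → Walk Γ u v j → k ≤ j)

Dist-sym : ∀ {Γ u v k} → Dist Γ u v k → Dist Γ v u k
Dist-sym (w , m) = reverse w , λ j w' → m j (reverse w')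

Connected : Graph → Set
Connected Γ = ∀ u v → ∃[ k ] Walk Γ u v k

dist2 : Graph → Graph
dist2 Γ = record
  { n      = n Γ
  ; Adj    = λ u v → Dist Γ u v 2
  ; sym    = Dist-sym
  ; irrefl = λ { (_ , m) → noLe (m 0 []) }
  }
  where
  noLe : ¬ (2 ≤ 0)
  noLe ()

_≅_ : Graph → Graph → Set
Γ ≅ Δ = Σ (Fin (n Γ) ↔ Fin (n Δ)) λ f →
  ∀ u v → (Adj Γ u v → Adj Δ (Inverse.to f u) (Inverse.to f v))
        × (Adj Δ (Inverse.to f u) (Inverse.to f v) → Adj Γ u v)

-- Γ contains a (not necessarily induced) subgraph isomorphic to H:
-- an injective vertex map sending edges of H to edges of Γ.
_⊆_ : Graph → Graph → Set
H ⊆ Γ = Σ (Fin (n H) → Fin (n Γ)) λ f →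
  Injective _≡_ _≡_ f × (∀ u v → Adj H u v → Adj Γ (f u) (f v))

-- Cycle C_k with k = 3 + m vertices on Fin k: i ~ j iff j ≡ i+1 (mod k) or i ≡ j+1 (mod k).
-- (The extra conjunct i ≢ j is automatic for k ≥ 3; it just makes irreflexivity immediate.)
cycle : ℕ → Graph
cycle m = record
  { n      = suc (suc (suc m))
  ; Adj    = λ i j → ¬ (i ≡ j) × (Nxt i j ⊎ Nxt j i)
  ; sym    = λ { (ne , a) → (λ e → ne (Eq.sym e)) , Data.Sum.swap a }
  ; irrefl = λ { (ne , _) → ne Eq.refl }
  }
  where
  Nxt : Fin (suc (suc (suc m))) → Fin (suc (suc (suc m))) → Set
  Nxt i j = toℕ j ≡ suc (toℕ i) % suc (suc (suc m))

-- Γ is a cycle of odd length.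
-- Γ is a cycle of odd length: Γ ≅ C_(2j+3) for some j.
IsOddCycle : Graph → Set
IsOddCycle Γ = ∃[ j ] (Γ ≅ cycle (2 * j))

data E53 : Fin 6 → Fin 6 → Set where
  ab : E53 0F 1F
  bc : E53 1F 2F
  cd : E53 2F 3F
  de : E53 3F 4F
  ef : E53 4F 5F
  fa : E53 5F 0F
  bf : E53 1F 5F

C5|C3 : Graph
C5|C3 = record
  { n      = 6
  ; Adj    = λ u v → E53 u v ⊎ E53 v u
  ; sym    = Data.Sum.swap
  ; irrefl = λ { (inj₁ ()) ; (inj₂ ()) }
  }

C4 : Graph
C4 = cycle 1

module Submission where

-- Let Γ be C4-free with Γ₂ ≅ Γ, and let a,b,c,d,e,f be a copy of
-- C₅|C₃ in Γ (edges ab,bc,cd,de,ef,fa,bf).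
--  * Two distinct vertices of a C4-free graph have at most one common neighbour;
--    hence the copy is induced, and the seven pairs ac,cf,fd,db,be,ea,ce are at
--    distance two, i.e. they span a second copy of C₅|C₃, this time in Γ₂.
--  * Both Γ and Γ₂ are C4-free (Γ₂ ≅ Γ); then every vertex of Γ has degree ≤ 3,
--    since four neighbours of one vertex would contain a 4-cycle at distance two.
--    Transporting along Γ₂ ≅ Γ, the same holds for Γ₂ and for (Γ₂)₂.
--  * Degree counting in Γ, Γ₂ and (Γ₂)₂ shows that no vertex outside the copy is
--    adjacent to it; the vertex d plays a special role, being shared by both copies.
--  * By connectivity the copy exhausts Γ, and being induced it is all of Γ.

open import Defs
open import Data.Nat using (ℕ; suc; _≤_; z≤n; s≤s)
open import Data.Product using (_×_; _,_; proj₁; proj₂; ∃)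
open import Data.Sum using (_⊎_; inj₁; inj₂)
open import Data.Empty using (⊥; ⊥-elim)
open import Data.Fin using (Fin; _≟_)
open import Data.Fin.Patterns using (0F; 1F; 2F; 3F; 4F; 5F)
open import Data.Fin.Properties using (any?)
open import Relation.Nullary using (¬_; yes; no)
open import Relation.Binary.PropositionalEquality using (_≡_; _≢_; refl; ≢-sym; subst₂; cong)
import Relation.Binary.PropositionalEquality as Eq
open import Function.Bundles using (Inverse; mk↔ₛ′)

byCases : {P : Set} → (P → ⊥) → (¬ P → ⊥) → ⊥
byCases holds fails = fails holds

adj⇒≢ : (G : Graph) {x y : Fin (n G)} → Adj G x y → x ≢ y
adj⇒≢ G xy refl = irrefl G xy

¬adj-sym : (G : Graph) {x y : Fin (n G)} → ¬ Adj G x y → ¬ Adj G y x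
¬adj-sym G ¬xy yx = ¬xy (sym G yx)

dist₂ : (G : Graph) {x y w : Fin (n G)} → x ≢ y → ¬ Adj G x y →
        Adj G x w → Adj G w y → Adj (dist2 G) x y
dist₂ G {x} {y} x≢y ¬xy xw wy = xw ∷ (wy ∷ []) , minimal
  where
  minimal : ∀ j → Walk G x y j → 2 ≤ j
  minimal 0 []             = ⊥-elim (x≢y refl)
  minimal 1 (xy ∷ [])      = ⊥-elim (¬xy xy)
  minimal (suc (suc j)) _  = s≤s (s≤s z≤n)

Distinct4 : {A : Set} → A → A → A → A → Set
Distinct4 p q r s = p ≢ q × p ≢ r × p ≢ s × q ≢ r × q ≢ s × r ≢ s

Distinct4-swap₂₃ : {A : Set} {p q r s : A} → Distinct4 p q r s → Distinct4 p r q s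
Distinct4-swap₂₃ (pq , pr , ps , qr , qs , rs) = pr , pq , ps , ≢-sym qr , rs , qs

Distinct4-swap₃₄ : {A : Set} {p q r s : A} → Distinct4 p q r s → Distinct4 p q s r
Distinct4-swap₃₄ (pq , pr , ps , qr , qs , rs) = pq , ps , pr , qs , qr , ≢-sym rs

square⇒C4 : (G : Graph) (p q r s : Fin (n G)) → Distinct4 p q r s →
            Adj G p q → Adj G q r → Adj G r s → Adj G s p → C4 ⊆ G
square⇒C4 G p q r s (pq , pr , ps , qr , qs , rs) e₁ e₂ e₃ e₄ = corner , injective , edges
  where
  corner : Fin 4 → Fin (n G)
  corner 0F = p
  corner 1F = q
  corner 2F = r
  corner 3F = s
  injective : ∀ {i j} → corner i ≡ corner j → i ≡ j
  injective {0F} {0F} _ = refl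
  injective {0F} {1F} x = ⊥-elim (pq x)
  injective {0F} {2F} x = ⊥-elim (pr x)
  injective {0F} {3F} x = ⊥-elim (ps x)
  injective {1F} {0F} x = ⊥-elim (pq (Eq.sym x))
  injective {1F} {1F} _ = refl
  injective {1F} {2F} x = ⊥-elim (qr x)
  injective {1F} {3F} x = ⊥-elim (qs x)
  injective {2F} {0F} x = ⊥-elim (pr (Eq.sym x))
  injective {2F} {1F} x = ⊥-elim (qr (Eq.sym x))
  injective {2F} {2F} _ = refl
  injective {2F} {3F} x = ⊥-elim (rs x)
  injective {3F} {0F} x = ⊥-elim (ps (Eq.sym x))
  injective {3F} {1F} x = ⊥-elim (qs (Eq.sym x))
  injective {3F} {2F} x = ⊥-elim (rs (Eq.sym x))
  injective {3F} {3F} _ = refl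
  edges : ∀ i j → Adj C4 i j → Adj G (corner i) (corner j)
  edges 0F 1F _ = e₁
  edges 1F 0F _ = sym G e₁
  edges 1F 2F _ = e₂
  edges 2F 1F _ = sym G e₂
  edges 2F 3F _ = e₃
  edges 3F 2F _ = sym G e₃
  edges 3F 0F _ = e₄
  edges 0F 3F _ = sym G e₄
  edges 0F 0F (ne , _) = ⊥-elim (ne refl)
  edges 1F 1F (ne , _) = ⊥-elim (ne refl)
  edges 2F 2F (ne , _) = ⊥-elim (ne refl)
  edges 3F 3F (ne , _) = ⊥-elim (ne refl)
  edges 0F 2F (_ , inj₁ ())
  edges 0F 2F (_ , inj₂ ())
  edges 2F 0F (_ , inj₁ ())
  edges 2F 0F (_ , inj₂ ())
  edges 1F 3F (_ , inj₁ ())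
  edges 1F 3F (_ , inj₂ ())
  edges 3F 1F (_ , inj₁ ())
  edges 3F 1F (_ , inj₂ ())

C4-free : Graph → Set
C4-free G = ¬ (C4 ⊆ G)

atMostOneCommonNeighbour : (G : Graph) → C4-free G → {x y w w′ : Fin (n G)} →
  x ≢ y → w ≢ w′ → Adj G x w → Adj G w y → Adj G x w′ → Adj G w′ y → ⊥
atMostOneCommonNeighbour G noC4 x≢y w≢w′ xw wy xw′ w′y =
  noC4 (square⇒C4 G _ _ _ _
          (adj⇒≢ G xw , x≢y , adj⇒≢ G xw′ , adj⇒≢ G wy , w≢w′ , adj⇒≢ G (sym G w′y))
          xw wy (sym G w′y) (sym G xw′))

MaxDegree3 : Graph → Set
MaxDegree3 G = ∀ v p q r s → Distinct4 p q r s →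
  Adj G v p → Adj G v q → Adj G v r → Adj G v s → ⊥

-- If G and G₂ are both C4-free then G has maximum degree at most 3: the edges among
-- four neighbours of v form a matching, so its complement contains a 4-cycle, all of
-- whose pairs are at distance two.
-- The cases: an edge pq or rs leaves the 4-cycle p r q s at distance two, an edge qr or
-- sp leaves p q s r, and without any of these p q r s itself works.
maxDegree3 : (G : Graph) → C4-free G → C4-free (dist2 G) → MaxDegree3 G
maxDegree3 G noC4 noC4₂ v p q r s ds@(pq , pr , ps , qr , qs , rs) vp vq vr vs =
  byCases (λ p~q → cycle₂ (Distinct4-swap₂₃ ds) vp vr vq vs
              (isolated qr vp vq vr p~q) (¬adj-sym G (isolated pr vq vp vr (sym G p~q)))
              (isolated ps vq vp vs (sym G p~q)) (¬adj-sym G (isolated qs vp vq vs p~q)))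
  λ ¬p~q → byCases (λ r~s → cycle₂ (Distinct4-swap₂₃ ds) vp vr vq vs
              (¬adj-sym G (isolated (≢-sym ps) vr vs vp r~s)) (isolated (≢-sym qs) vr vs vq r~s)
              (¬adj-sym G (isolated (≢-sym qr) vs vr vq (sym G r~s))) (isolated (≢-sym pr) vs vr vp (sym G r~s)))
  λ ¬r~s → byCases (λ q~r → cycle₂ (Distinct4-swap₃₄ ds) vp vq vs vr
              ¬p~q (isolated rs vq vr vs q~r) (¬adj-sym G ¬r~s) (isolated (≢-sym pq) vr vq vp (sym G q~r)))
  λ ¬q~r → byCases (λ s~p → cycle₂ (Distinct4-swap₃₄ ds) vp vq vs vr
              ¬p~q (¬adj-sym G (isolated pq vs vp vq s~p)) (¬adj-sym G ¬r~s) (¬adj-sym G (isolated (≢-sym rs) vp vs vr (sym G s~p))))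
  λ ¬s~p → cycle₂ ds vp vq vr vs ¬p~q ¬q~r ¬r~s ¬s~p
  where
  -- An edge xy between neighbours of v keeps x away from any other neighbour w:
  -- otherwise v and x would have the two common neighbours y and w.
  isolated : ∀ {x y w} → y ≢ w → Adj G v x → Adj G v y → Adj G v w → Adj G x y → ¬ Adj G x w
  isolated y≢w vx vy vw xy xw =
    atMostOneCommonNeighbour G noC4 (adj⇒≢ G vx) y≢w vy (sym G xy) vw (sym G xw)
  far : ∀ {x y} → x ≢ y → ¬ Adj G x y → Adj G v x → Adj G v y → Adj (dist2 G) x y
  far x≢y ¬xy vx vy = dist₂ G x≢y ¬xy (sym G vx) vy
  cycle₂ : ∀ {x y z w} → Distinct4 x y z w → Adj G v x → Adj G v y → Adj G v z → Adj G v w →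
           ¬ Adj G x y → ¬ Adj G y z → ¬ Adj G z w → ¬ Adj G w x → ⊥
  cycle₂ {x} {y} {z} {w} dxyzw@(xy , _ , xw , yz , _ , zw) vx vy vz vw ¬xy ¬yz ¬zw ¬wx =
    noC4₂ (square⇒C4 (dist2 G) x y z w dxyzw
             (far xy ¬xy vx vy) (far yz ¬yz vy vz) (far zw ¬zw vz vw) (far (≢-sym xw) ¬wx vw vx))

module _ (A B : Graph) (φ : A ≅ B) where
  private
    to : Fin (n A) → Fin (n B)
    to = Inverse.to (proj₁ φ)
    from : Fin (n B) → Fin (n A)
    from = Inverse.from (proj₁ φ)
    from-to : ∀ x → from (to x) ≡ x
    from-to = Inverse.strictlyInverseʳ (proj₁ φ)
    to-from : ∀ y → to (from y) ≡ y
    to-from = Inverse.strictlyInverseˡ (proj₁ φ)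
    to-injective : ∀ {x y} → to x ≡ to y → x ≡ y
    to-injective {x} {y} e = Eq.trans (Eq.sym (from-to x)) (Eq.trans (cong from e) (from-to y))
    adj-to : ∀ {x y} → Adj A x y → Adj B (to x) (to y)
    adj-to {x} {y} = proj₁ (proj₂ φ x y)
    adj-from : ∀ {x y} → Adj B x y → Adj A (from x) (from y)
    adj-from {x} {y} e =
      proj₂ (proj₂ φ (from x) (from y)) (subst₂ (Adj B) (Eq.sym (to-from x)) (Eq.sym (to-from y)) e)
    walk-to : ∀ {x y k} → Walk A x y k → Walk B (to x) (to y) k
    walk-to [] = []
    walk-to (e ∷ w) = adj-to e ∷ walk-to w
    walk-from : ∀ {x y k} → Walk B (to x) (to y) k → Walk A x y k
    walk-from {x} {y} {k} w = subst₂ (λ u v → Walk A u v k) (from-to x) (from-to y) (go w)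
      where
      go : ∀ {u v k} → Walk B u v k → Walk A (from u) (from v) k
      go [] = []
      go (e ∷ w) = adj-from e ∷ go w

  ⊆-≅ : {H : Graph} → H ⊆ A → H ⊆ B
  ⊆-≅ (g , g-inj , g-adj) = (λ i → to (g i)) , (λ e → g-inj (to-injective e)) , λ i j e → adj-to (g-adj i j e)

  -- Walks, hence distances, correspond under the isomorphism.
  dist2-≅ : dist2 A ≅ dist2 B
  dist2-≅ = proj₁ φ , λ x y → (λ { (w , min) → walk-to w , λ j w′ → min j (walk-from w′) })
                            , (λ { (w , min) → walk-from w , λ j w′ → min j (walk-to w′) })

  maxDegree3-≅ : MaxDegree3 B → MaxDegree3 A
  maxDegree3-≅ deg v p q r s (pq , pr , ps , qr , qs , rs) vp vq vr vs =
    deg (to v) (to p) (to q) (to r) (to s)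
        (to-≢ pq , to-≢ pr , to-≢ ps , to-≢ qr , to-≢ qs , to-≢ rs)
        (adj-to vp) (adj-to vq) (adj-to vr) (adj-to vs)
    where
    to-≢ : ∀ {x y} → x ≢ y → to x ≢ to y
    to-≢ x≢y e = x≢y (to-injective e)

module Copy (G : Graph) (noC4 : C4-free G) (h : C5|C3 ⊆ G) where
  g : Fin 6 → Fin (n G)
  g = proj₁ h

  apart : ∀ {i j} → i ≢ j → g i ≢ g j
  apart i≢j e = i≢j (proj₁ (proj₂ h) e)

  a b c d e f : Fin (n G)
  a = g 0F
  b = g 1F
  c = g 2F
  d = g 3F
  e = g 4F
  f = g 5F

  fwd : ∀ {i j} → E53 i j → Adj G (g i) (g j)
  fwd x = proj₂ (proj₂ h) _ _ (inj₁ x)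
  bwd : ∀ {i j} → E53 i j → Adj G (g j) (g i)
  bwd x = proj₂ (proj₂ h) _ _ (inj₂ x)

  -- The copy is induced: every chord would give two common neighbours to two vertices.
  ¬ac : ¬ Adj G a c
  ¬ac ac = atMostOneCommonNeighbour G noC4 (apart (λ ())) (apart (λ ())) ac (bwd bc) (bwd fa) (bwd bf)
  ¬ad : ¬ Adj G a d
  ¬ad ad = atMostOneCommonNeighbour G noC4 (apart (λ ())) (apart (λ ())) (fwd ab) (fwd bc) ad (bwd cd)
  ¬ae : ¬ Adj G a e
  ¬ae ae = atMostOneCommonNeighbour G noC4 (apart (λ ())) (apart (λ ())) ae (fwd ef) (fwd ab) (fwd bf)
  ¬bd : ¬ Adj G b d
  ¬bd bd = atMostOneCommonNeighbour G noC4 (apart (λ ())) (apart (λ ())) bd (fwd de) (fwd bf) (bwd ef)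
  ¬be : ¬ Adj G b e
  ¬be be = atMostOneCommonNeighbour G noC4 (apart (λ ())) (apart (λ ())) be (bwd de) (fwd bc) (fwd cd)
  ¬ce : ¬ Adj G c e
  ¬ce ce = atMostOneCommonNeighbour G noC4 (apart (λ ())) (apart (λ ())) ce (fwd ef) (bwd bc) (fwd bf)
  ¬cf : ¬ Adj G c f
  ¬cf cf = atMostOneCommonNeighbour G noC4 (apart (λ ())) (apart (λ ())) cf (fwd fa) (bwd bc) (bwd ab)
  ¬df : ¬ Adj G d f
  ¬df df = atMostOneCommonNeighbour G noC4 (apart (λ ())) (apart (λ ())) df (bwd bf) (bwd cd) (bwd bc)

  induced : ∀ i j → Adj G (g i) (g j) → Adj C5|C3 i j
  induced 0F 1F _ = inj₁ ab
  induced 1F 2F _ = inj₁ bc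
  induced 2F 3F _ = inj₁ cd
  induced 3F 4F _ = inj₁ de
  induced 4F 5F _ = inj₁ ef
  induced 5F 0F _ = inj₁ fa
  induced 1F 5F _ = inj₁ bf
  induced 1F 0F _ = inj₂ ab
  induced 2F 1F _ = inj₂ bc
  induced 3F 2F _ = inj₂ cd
  induced 4F 3F _ = inj₂ de
  induced 5F 4F _ = inj₂ ef
  induced 0F 5F _ = inj₂ fa
  induced 5F 1F _ = inj₂ bf
  induced 0F 2F x = ⊥-elim (¬ac x)
  induced 0F 3F x = ⊥-elim (¬ad x)
  induced 0F 4F x = ⊥-elim (¬ae x)
  induced 1F 3F x = ⊥-elim (¬bd x)
  induced 1F 4F x = ⊥-elim (¬be x)
  induced 2F 4F x = ⊥-elim (¬ce x)
  induced 2F 5F x = ⊥-elim (¬cf x)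
  induced 3F 5F x = ⊥-elim (¬df x)
  induced 2F 0F x = ⊥-elim (¬ac (sym G x))
  induced 3F 0F x = ⊥-elim (¬ad (sym G x))
  induced 4F 0F x = ⊥-elim (¬ae (sym G x))
  induced 3F 1F x = ⊥-elim (¬bd (sym G x))
  induced 4F 1F x = ⊥-elim (¬be (sym G x))
  induced 4F 2F x = ⊥-elim (¬ce (sym G x))
  induced 5F 2F x = ⊥-elim (¬cf (sym G x))
  induced 5F 3F x = ⊥-elim (¬df (sym G x))
  induced 0F 0F x = ⊥-elim (irrefl G x)
  induced 1F 1F x = ⊥-elim (irrefl G x)
  induced 2F 2F x = ⊥-elim (irrefl G x)
  induced 3F 3F x = ⊥-elim (irrefl G x)
  induced 4F 4F x = ⊥-elim (irrefl G x)
  induced 5F 5F x = ⊥-elim (irrefl G x)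

  ac₂ : Adj (dist2 G) a c
  ac₂ = dist₂ G (apart (λ ())) ¬ac (fwd ab) (fwd bc)
  cf₂ : Adj (dist2 G) c f
  cf₂ = dist₂ G (apart (λ ())) ¬cf (bwd bc) (fwd bf)
  fd₂ : Adj (dist2 G) f d
  fd₂ = dist₂ G (apart (λ ())) (¬adj-sym G ¬df) (bwd ef) (bwd de)
  db₂ : Adj (dist2 G) d b
  db₂ = dist₂ G (apart (λ ())) (¬adj-sym G ¬bd) (bwd cd) (bwd bc)
  be₂ : Adj (dist2 G) b e
  be₂ = dist₂ G (apart (λ ())) ¬be (fwd bf) (bwd ef)
  ea₂ : Adj (dist2 G) e a
  ea₂ = dist₂ G (apart (λ ())) (¬adj-sym G ¬ae) (fwd ef) (fwd fa)
  ce₂ : Adj (dist2 G) c e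
  ce₂ = dist₂ G (apart (λ ())) ¬ce (fwd cd) (fwd de)

  -- The relabelling a,c,f,d,b,e of the copy is a copy of C₅|C₃ in G₂; it fixes d.
  σ σ⁻¹ : Fin 6 → Fin 6
  σ 0F = 0F
  σ 1F = 2F
  σ 2F = 5F
  σ 3F = 3F
  σ 4F = 1F
  σ 5F = 4F
  σ⁻¹ 0F = 0F
  σ⁻¹ 1F = 4F
  σ⁻¹ 2F = 1F
  σ⁻¹ 3F = 3F
  σ⁻¹ 4F = 5F
  σ⁻¹ 5F = 2F

  σ⁻¹∘σ : ∀ i → σ⁻¹ (σ i) ≡ i
  σ⁻¹∘σ 0F = refl
  σ⁻¹∘σ 1F = refl
  σ⁻¹∘σ 2F = refl
  σ⁻¹∘σ 3F = refl
  σ⁻¹∘σ 4F = refl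
  σ⁻¹∘σ 5F = refl

  copy₂ : C5|C3 ⊆ dist2 G
  copy₂ = (λ i → g (σ i)) , injective , edges
    where
    injective : ∀ {i j} → g (σ i) ≡ g (σ j) → i ≡ j
    injective {i} {j} x =
      Eq.trans (Eq.sym (σ⁻¹∘σ i)) (Eq.trans (cong σ⁻¹ (proj₁ (proj₂ h) x)) (σ⁻¹∘σ j))
    edge : ∀ i j → E53 i j → Adj (dist2 G) (g (σ i)) (g (σ j))
    edge _ _ ab = ac₂
    edge _ _ bc = cf₂
    edge _ _ cd = fd₂
    edge _ _ de = db₂
    edge _ _ ef = be₂
    edge _ _ fa = ea₂
    edge _ _ bf = ce₂
    edges : ∀ i j → Adj C5|C3 i j → Adj (dist2 G) (g (σ i)) (g (σ j))
    edges i j (inj₁ x) = edge i j x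
    edges i j (inj₂ x) = Dist-sym (edge j i x)

  Outside : Fin (n G) → Set
  Outside z = ∀ i → g i ≢ z

  -- If G₂ has maximum degree 3, no vertex outside the copy is adjacent to d:
  -- according to its adjacency with c, either c or e would get a fourth G₂-neighbour.
  ¬outside~d : MaxDegree3 (dist2 G) → ∀ {z} → Outside z → ¬ Adj G z d
  ¬outside~d deg₂ {z} out zd = byCases
    (λ zc → byCases
      (λ ze → atMostOneCommonNeighbour G noC4 (apart (λ ())) (≢-sym (out 3F)) (sym G zc) ze (fwd cd) (fwd de))
      (λ ¬ze → deg₂ e a b c z (apart (λ ()) , apart (λ ()) , out 0F , apart (λ ()) , out 1F , out 2F)
                 ea₂ (Dist-sym be₂) (Dist-sym ce₂) (dist₂ G (out 4F) (¬adj-sym G ¬ze) (bwd de) (sym G zd))))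
    (λ ¬zc → deg₂ c a e f z (apart (λ ()) , apart (λ ()) , out 0F , apart (λ ()) , out 4F , out 5F)
               (Dist-sym ac₂) ce₂ cf₂ (dist₂ G (out 2F) (¬adj-sym G ¬zc) (fwd cd) (sym G zd)))

module Isolation (G : Graph) (noC4 : C4-free G) (noC4₂ : C4-free (dist2 G))
                 (deg : MaxDegree3 G) (deg₂ : MaxDegree3 (dist2 G))
                 (deg₂₂ : MaxDegree3 (dist2 (dist2 G))) (h : C5|C3 ⊆ G) where
  open Copy G noC4 h
  module Copy₂ = Copy (dist2 G) noC4₂ copy₂

  -- The vertices c and e are handled through d, which belongs to both copies:
  -- a neighbour z of c or e is adjacent to d either in G or in G₂.
  via-d : ∀ {z i} → Outside z → Adj G (g i) d → Adj G (g i) z → ⊥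
  via-d {z} out id iz = byCases (¬outside~d deg₂ out)
    λ ¬zd → Copy₂.¬outside~d deg₂₂ (λ i → out (σ i))
              (dist₂ G (≢-sym (out 3F)) ¬zd (sym G iz) id)

  -- b and f already have three neighbours in the copy.
  ¬b~outside : ∀ {z} → Outside z → ¬ Adj G b z
  ¬b~outside out bz = deg b a c f _ (apart (λ ()) , apart (λ ()) , out 0F , apart (λ ()) , out 2F , out 5F)
      (bwd ab) (fwd bc) (fwd bf) bz
  ¬f~outside : ∀ {z} → Outside z → ¬ Adj G f z
  ¬f~outside out fz = deg f a b e _ (apart (λ ()) , apart (λ ()) , out 0F , apart (λ ()) , out 1F , out 4F)
      (fwd fa) (bwd bf) (bwd ef) fz

  -- A neighbour z of a would make z, b, d, f a 4-cycle in G₂.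
  closed : ∀ {z} → Outside z → ∀ i → ¬ Adj G (g i) z
  closed out 0F az = noC4₂ (square⇒C4 (dist2 G) _ b d f
      (≢-sym (out 1F) , ≢-sym (out 3F) , ≢-sym (out 5F) , apart (λ ()) , apart (λ ()) , apart (λ ()))
      (dist₂ G (≢-sym (out 1F)) (λ zb → ¬b~outside out (sym G zb)) (sym G az) (fwd ab))
      (Dist-sym db₂) (Dist-sym fd₂)
      (dist₂ G (out 5F) (¬f~outside out) (fwd fa) az))
  closed out 1F bz = ¬b~outside out bz
  closed out 2F cz = via-d out (fwd cd) cz
  closed out 3F dz = ¬outside~d deg₂ out (sym G dz)
  closed out 4F ez = via-d out (bwd de) ez
  closed out 5F fz = ¬f~outside out fz

InImage : {k m : ℕ} → (Fin k → Fin m) → Fin m → Set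
InImage g z = ∃ λ i → g i ≡ z

inImage? : {k m : ℕ} (g : Fin k → Fin m) (z : Fin m) → InImage g z ⊎ (∀ i → g i ≢ z)
inImage? g z with any? (λ i → g i ≟ z)
... | yes z∈g = inj₁ z∈g
... | no z∉g = inj₂ (λ i gi≡z → z∉g (i , gi≡z))

closed-image-covers : (G : Graph) → Connected G → {k : ℕ} (g : Fin (suc k) → Fin (n G)) →
  (∀ {z} → (∀ i → g i ≢ z) → ∀ i → ¬ Adj G (g i) z) → ∀ z → InImage g z
closed-image-covers G conn {k} g closed z with inImage? g z
... | inj₁ z∈g = z∈g
... | inj₂ z∉g = ⊥-elim (escape (proj₂ (conn (g 0F) z)) (0F , refl) z∉g)
  where
  escape : ∀ {u v j} → Walk G u v j → InImage g u → (∀ i → g i ≢ v) → ⊥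
  escape [] (i , gi≡u) v∉g = v∉g i gi≡u
  escape (_∷_ {w = w} uw rest) (i , refl) v∉g with inImage? g w
  ... | inj₁ w∈g = escape rest w∈g v∉g
  ... | inj₂ w∉g = closed w∉g i uw

spanning-induced⇒≅ : (H G : Graph) (h : H ⊆ G) → (∀ z → InImage (proj₁ h) z) →
  (∀ i j → Adj G (proj₁ h i) (proj₁ h j) → Adj H i j) → G ≅ H
spanning-induced⇒≅ H G (g , g-inj , g-adj) onto induced =
  mk↔ₛ′ back g (λ i → g-inj (proj₂ (onto (g i)))) g∘back , adjacency
  where
  back : Fin (n G) → Fin (n H)
  back z = proj₁ (onto z)
  g∘back : ∀ z → g (back z) ≡ z
  g∘back z = proj₂ (onto z)
  adjacency : ∀ u v → (Adj G u v → Adj H (back u) (back v)) × (Adj H (back u) (back v) → Adj G u v)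
  adjacency u v = (λ uv → induced _ _ (subst₂ (Adj G) (Eq.sym (g∘back u)) (Eq.sym (g∘back v)) uv))
                , (λ x → subst₂ (Adj G) (g∘back u) (g∘back v) (g-adj _ _ x))

lemma3p2 : (Γ : Graph) → 2 ≤ n Γ → Connected Γ → dist2 Γ ≅ Γ → ¬ (C4 ⊆ Γ) → ¬ IsOddCycle Γ
    → C5|C3 ⊆ Γ → Γ ≅ C5|C3
lemma3p2 Γ _ conn φ noC4 _ h =
  spanning-induced⇒≅ C5|C3 Γ h (closed-image-covers Γ conn (proj₁ h) closed) induced
  where
  noC4₂ : C4-free (dist2 Γ)
  noC4₂ c4 = noC4 (⊆-≅ (dist2 Γ) Γ φ {C4} c4)
  deg : MaxDegree3 Γ
  deg = maxDegree3 Γ noC4 noC4₂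
  deg₂ : MaxDegree3 (dist2 Γ)
  deg₂ = maxDegree3-≅ (dist2 Γ) Γ φ deg
  deg₂₂ : MaxDegree3 (dist2 (dist2 Γ))
  deg₂₂ = maxDegree3-≅ (dist2 (dist2 Γ)) (dist2 Γ) (dist2-≅ (dist2 Γ) Γ φ) deg₂
  open Copy Γ noC4 h using (induced)
  open Isolation Γ noC4 noC4₂ deg deg₂ deg₂₂ h using (closed)
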